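{- Let $X\subseteq\mathbb{R}^d$ be finite, let $k\le|X|$ and $u$ be positive integers with $ku\ge|X|$, and let $S\subseteq\mathbb{R}^d$ be a finite nonempty set. Among all families $C=(c_1,\dots,c_k)$ of $k$ points of $S$ (repetitions allowed) and all assignments $\pi:X\to\{1,\dots,k\}$ with $|\pi^{ -1}(i)|\le u$ for all $i$, choose one pair $(C,\pi_{\mathbb{H}})$ minimizing $\mathrm{cost}_{\mathbb{H}}(C,\pi_{\mathbb{H}})$, and then let $\pi_C$ be an assignment $X\to\{1,\dots,k\}$ with all fibres of size at most $u$ minimizing $\sum_{x\in X}d(x,c_{\pi_C(x)})$. Then $(C,\pi_C)$ is a feasible HCKM solution and $$\mathrm{cost}_{\mathbb{D}}(C,\pi_C)\le 3\,\mathrm{OPT}_{\mathbb{H}}.$$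
   Context: For $a,b\in\mathbb{R}^d$ let $d(a,b)=\|a-b\|^2$. A feasible HCKM solution on $(X,k,u)$ is a family $C=(c_1,\dots,c_k)$ of points of $\mathbb{R}^d$ (repetitions allowed) with an assignment $\pi:X\to\{1,\dots,k\}$ such that $|\pi^{ -1}(i)|\le u$ for all $i$; $\mathrm{cost}_{\mathbb{D}}(C,\pi)=\sum_{x\in X}d(x,c_{\pi(x)})$. Fix a map $\pi_{vor}:\mathbb{R}^d\to S$ with $\pi_{vor}(x)\in\arg\min_{s\in S}d(x,s)$, and let $h(x,y)=d(x,\pi_{vor}(x))+d(\pi_{vor}(x),\pi_{vor}(y))+d(\pi_{vor}(y),y)$. Define $\mathrm{cost}_{\mathbb{H}}(C,\pi)=\sum_{x\in X}h(x,c_{\pi(x)})$, and $\mathrm{OPT}_{\mathbb{H}}$ as the minimum of $\mathrm{cost}_{\mathbb{H}}(C,\pi)$ over all feasible solutions (centers anywhere in $\mathbb{R}^d$). -}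

module Defs where

open import Level using (0ℓ)
open import Data.Nat as ℕ using (ℕ; zero; suc)
open import Data.Fin using (Fin; zero; suc; _≟_)
open import Data.Product using (Σ; ∃; _×_; _,_)
open import Relation.Nullary using (¬_; yes; no)
open import Relation.Binary using (Rel; IsTotalOrder)
open import Relation.Binary.PropositionalEquality using (_≡_)
open import Algebra.Core using (Op₁; Op₂)
open import Algebra.Structures using (IsCommutativeRing)

-- The real numbers, axiomatised as a complete (Dedekind/least-upper-bound)
-- totally ordered field.  Any model is isomorphic to ℝ.
record RealField : Set₁ where
  infixl 6 _+_ _-_
  infixl 7 _*_
  infix 4 _≤_
  field
    Carrier : Set
    _+_ _*_ : Op₂ Carrier
    -_ : Op₁ Carrier
    0# 1# : Carrier
    isCommutativeRing : IsCommutativeRing _≡_ _+_ _*_ -_ 0# 1#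
    0≢1 : ¬ (0# ≡ 1#)
    inverse : ∀ x → ¬ (x ≡ 0#) → ∃ λ y → x * y ≡ 1#
    _≤_ : Rel Carrier 0ℓ
    isTotalOrder : IsTotalOrder _≡_ _≤_
    +-monoˡ-≤ : ∀ {x y} z → x ≤ y → x + z ≤ y + z
    *-nonneg : ∀ {x y} → 0# ≤ x → 0# ≤ y → 0# ≤ x * y
    complete : (P : Carrier → Set) → ∃ P → (∃ λ b → ∀ x → P x → x ≤ b) →
               ∃ λ s → (∀ x → P x → x ≤ s) × (∀ b → (∀ x → P x → x ≤ b) → s ≤ b)

  _-_ : Op₂ Carrier
  x - y = x + (- y)

module Geometry (R : RealField) where
  open RealField R

  ∑ : ∀ {n} → (Fin n → Carrier) → Carrier
  ∑ {zero} f = 0#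
  ∑ {suc n} f = f zero + ∑ (λ i → f (suc i))

  Point : ℕ → Set
  Point d = Fin d → Carrier

  dist : ∀ {d} → Point d → Point d → Carrier
  dist a b = ∑ (λ i → (a i - b i) * (a i - b i))

  fibreSize : ∀ {n k} → (Fin n → Fin k) → Fin k → ℕ
  fibreSize {zero} π i = zero
  fibreSize {suc n} π i with π zero ≟ i
  ... | yes _ = suc (fibreSize (λ j → π (suc j)) i)
  ... | no _  = fibreSize (λ j → π (suc j)) i

  Feasible : ∀ {n k} → ℕ → (Fin n → Fin k) → Set
  Feasible u π = ∀ i → fibreSize π i ℕ.≤ u

  -- S is given as S : Fin m → Point d; a Voronoi map sends each point to
  -- (the index of) a nearest point of S.
  IsVoronoi : ∀ {d m} → (Fin m → Point d) → (Point d → Fin m) → Set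
  IsVoronoi {d} S vor = ∀ (x : Point d) j → dist x (S (vor x)) ≤ dist x (S j)

  hdist : ∀ {d m} → (Fin m → Point d) → (Point d → Fin m) → Point d → Point d → Carrier
  hdist S vor x y = dist x (S (vor x)) + dist (S (vor x)) (S (vor y)) + dist (S (vor y)) y

  -- X is given as X : Fin n → Point d (injective), centres C : Fin k → Point d
  costD : ∀ {d n k} → (Fin n → Point d) → (Fin k → Point d) → (Fin n → Fin k) → Carrier
  costD X C π = ∑ (λ j → dist (X j) (C (π j)))

  costH : ∀ {d n k m} → (Fin m → Point d) → (Point d → Fin m) →
          (Fin n → Point d) → (Fin k → Point d) → (Fin n → Fin k) → Carrier
  costH S vor X C π = ∑ (λ j → hdist S vor (X j) (C (π j)))

  infix 4 _≤ℝ_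
  infixl 7 _·ℝ_
  _≤ℝ_ : Carrier → Carrier → Set
  _≤ℝ_ = _≤_
  _·ℝ_ : Carrier → Carrier → Carrier
  _·ℝ_ = _*_
  three : Carrier
  three = 1# + 1# + 1#

-- Moving every centre of a solution to its nearest site never increases the h-cost, because
-- a site is its own nearest site; so the optimality of (C, πH) among solutions with centres
-- in S gives costH(C, πH) ≤ OPT_H. Along the path x, vor x, vor c, c the squared distance
-- satisfies d(x, c) ≤ 3 h(x, c), and the optimality of πC for C finishes the bound:
-- costD(C, πC) ≤ costD(C, πH) ≤ 3 costH(C, πH) ≤ 3 OPT_H.
module Submission where

open import Defs
open import Level using (0ℓ)
import Data.Nat as ℕ
open import Data.Fin using (Fin; zero; suc)
open import Data.Product using (∃; _,_; _×_)
open import Data.Sum using (inj₁; inj₂)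
open import Data.Empty using (⊥-elim)
open import Relation.Nullary using (¬_)
open import Relation.Binary.Bundles using (Poset)
open import Relation.Binary.Structures using (IsTotalOrder)
open import Relation.Binary.PropositionalEquality
  using (_≡_; _≗_; refl; sym; trans; cong; cong₂; subst₂)
open import Algebra.Bundles using (CommutativeRing)
import Algebra.Properties.Ring as RingProperties
import Algebra.Solver.Ring.NaturalCoefficients.Default as Solver
import Relation.Binary.Reasoning.PartialOrder as ≤-Reasoning

module RealFieldProperties (R : RealField) where
  open RealField R
  open Geometry R using (three)

  commutativeRing : CommutativeRing 0ℓ 0ℓ
  commutativeRing = record { isCommutativeRing = isCommutativeRing }

  open CommutativeRing commutativeRing public
    using ( +-comm; +-identityˡ; +-identityʳ; -‿inverseˡ; -‿inverseʳ
          ; *-comm; *-identityˡ; zeroʳ; distribˡ; ring; commutativeSemiring)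
  open RingProperties ring public
    using ( -‿involutive; -‿distribˡ-*; -‿distribʳ-*; -0#≈0#
          ; x[y-z]≈xy-xz; x∙y⁻¹≈ε⇒x≈y)
  open Solver commutativeSemiring public using (solve; _:+_; _:*_; _:=_; con)
  open IsTotalOrder isTotalOrder public
    using ()
    renaming (refl to ≤-refl; trans to ≤-trans; antisym to ≤-antisym; total to ≤-total)

  poset : Poset 0ℓ 0ℓ 0ℓ
  poset = record { isPartialOrder = IsTotalOrder.isPartialOrder isTotalOrder }

  open ≤-Reasoning poset

  +-monoʳ-≤ : ∀ {x y} z → x ≤ y → z + x ≤ z + y
  +-monoʳ-≤ {x} {y} z x≤y = subst₂ _≤_ (+-comm x z) (+-comm y z) (+-monoˡ-≤ z x≤y)

  +-mono-≤ : ∀ {x y u v} → x ≤ y → u ≤ v → x + u ≤ y + v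
  +-mono-≤ {y = y} {u} x≤y u≤v = ≤-trans (+-monoˡ-≤ u x≤y) (+-monoʳ-≤ y u≤v)

  x≤y⇒0≤y-x : ∀ {x y} → x ≤ y → 0# ≤ y - x
  x≤y⇒0≤y-x {x} {y} x≤y = subst₂ _≤_ (-‿inverseʳ x) refl (+-monoˡ-≤ (- x) x≤y)

  0≤y-x⇒x≤y : ∀ {x y} → 0# ≤ y - x → x ≤ y
  0≤y-x⇒x≤y {x} {y} 0≤y-x = begin
    x             ≡⟨ +-identityˡ x ⟨
    0# + x        ≤⟨ +-monoˡ-≤ x 0≤y-x ⟩
    y - x + x     ≡⟨ solve 3 (λ y x -x → (y :+ -x) :+ x := y :+ (-x :+ x)) refl y x (- x) ⟩
    y + (- x + x) ≡⟨ cong (y +_) (-‿inverseˡ x) ⟩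
    y + 0#        ≡⟨ +-identityʳ y ⟩
    y             ∎

  x≤0⇒0≤-x : ∀ {x} → x ≤ 0# → 0# ≤ - x
  x≤0⇒0≤-x {x} x≤0 = subst₂ _≤_ refl (+-identityˡ (- x)) (x≤y⇒0≤y-x x≤0)

  -x*-x≡x*x : ∀ x → - x * - x ≡ x * x
  -x*-x≡x*x x = begin-equality
    - x * - x     ≡⟨ -‿distribˡ-* x (- x) ⟨
    - (x * - x)   ≡⟨ cong -_ (-‿distribʳ-* x x) ⟨
    - - (x * x)   ≡⟨ -‿involutive (x * x) ⟩
    x * x         ∎

  0≤x*x : ∀ x → 0# ≤ x * x
  0≤x*x x with ≤-total 0# x
  ... | inj₁ 0≤x = *-nonneg 0≤x 0≤x
  ... | inj₂ x≤0 = subst₂ _≤_ refl (-x*-x≡x*x x) (*-nonneg (x≤0⇒0≤-x x≤0) (x≤0⇒0≤-x x≤0))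

  *-monoˡ-≤-nonneg : ∀ {c x y} → 0# ≤ c → x ≤ y → c * x ≤ c * y
  *-monoˡ-≤-nonneg {c} {x} {y} 0≤c x≤y =
    0≤y-x⇒x≤y (subst₂ _≤_ refl (x[y-z]≈xy-xz c y x) (*-nonneg 0≤c (x≤y⇒0≤y-x x≤y)))

  0≤1 : 0# ≤ 1#
  0≤1 = subst₂ _≤_ refl (*-identityˡ 1#) (0≤x*x 1#)

  1≰0 : ¬ (1# ≤ 0#)
  1≰0 1≤0 = 0≢1 (≤-antisym 0≤1 1≤0)

  0≤x+y : ∀ {x y} → 0# ≤ x → 0# ≤ y → 0# ≤ x + y
  0≤x+y 0≤x 0≤y = subst₂ _≤_ (+-identityˡ 0#) refl (+-mono-≤ 0≤x 0≤y)

  0≤three : 0# ≤ three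
  0≤three = 0≤x+y (0≤x+y 0≤1 0≤1) 0≤1

  x*y+x*y≤x*x+y*y : ∀ x y → x * y + x * y ≤ x * x + y * y
  x*y+x*y≤x*x+y*y x y = begin
    x * y + x * y                              ≡⟨ +-identityˡ _ ⟨
    0# + (x * y + x * y)                       ≤⟨ +-monoˡ-≤ (x * y + x * y) (0≤x*x (x - y)) ⟩
    (x - y) * (x - y) + (x * y + x * y)        ≡⟨ solve 3 (λ x y -y →
                                                    (x :+ -y) :* (x :+ -y) :+ (x :* y :+ x :* y)
                                                  := x :* x :+ -y :* -y :+ (x :+ x) :* (y :+ -y))
                                                  refl x y (- y) ⟩
    x * x + - y * - y + (x + x) * (y - y)      ≡⟨ cong₂ (λ a b → x * x + a + (x + x) * b)
                                                    (-x*-x≡x*x y) (-‿inverseʳ y) ⟩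
    x * x + y * y + (x + x) * 0#               ≡⟨ cong (x * x + y * y +_) (zeroʳ (x + x)) ⟩
    x * x + y * y + 0#                         ≡⟨ +-identityʳ _ ⟩
    x * x + y * y                              ∎

  x+y≤0 : ∀ {x y} → x ≤ 0# → y ≤ 0# → x + y ≤ 0#
  x+y≤0 x≤0 y≤0 = subst₂ _≤_ refl (+-identityˡ 0#) (+-mono-≤ x≤0 y≤0)

  x+y≤z⇒y≤z-x : ∀ {x y z} → x + y ≤ z → y ≤ z - x
  x+y≤z⇒y≤z-x {x} {y} {z} x+y≤z = begin
    y              ≡⟨ +-identityʳ y ⟨
    y + 0#         ≡⟨ cong (y +_) (-‿inverseʳ x) ⟨
    y + (x - x)    ≡⟨ solve 3 (λ x y -x → y :+ (x :+ -x) := (x :+ y) :+ -x) refl x y (- x) ⟩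
    (x + y) - x    ≤⟨ +-monoˡ-≤ (- x) x+y≤z ⟩
    z - x          ∎

  x≤x-y⇒y≤0 : ∀ {x y} → x ≤ x - y → y ≤ 0#
  x≤x-y⇒y≤0 {x} {y} x≤x-y = 0≤y-x⇒x≤y (begin
    0#              ≤⟨ x≤y⇒0≤y-x x≤x-y ⟩
    (x - y) - x     ≡⟨ solve 3 (λ x -x -y → (x :+ -y) :+ -x := -y :+ (x :+ -x)) refl x (- x) (- y) ⟩
    - y + (x - x)   ≡⟨ cong (- y +_) (-‿inverseʳ x) ⟩
    - y + 0#        ≡⟨ +-comm (- y) 0# ⟩
    0# - y          ∎)

  [x+y]*[x+y]≤0 : ∀ {x y} → x * x ≤ 0# → y * y ≤ 0# → (x + y) * (x + y) ≤ 0#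
  [x+y]*[x+y]≤0 {x} {y} x*x≤0 y*y≤0 = begin
    (x + y) * (x + y)               ≡⟨ solve 2 (λ x y → (x :+ y) :* (x :+ y)
                                         := x :* x :+ y :* y :+ (x :* y :+ x :* y)) refl x y ⟩
    x * x + y * y + (x * y + x * y) ≤⟨ +-monoʳ-≤ (x * x + y * y) (x*y+x*y≤x*x+y*y x y) ⟩
    x * x + y * y + (x * x + y * y) ≤⟨ x+y≤0 x*x+y*y≤0 x*x+y*y≤0 ⟩
    0#                              ∎
    where
    x*x+y*y≤0 : x * x + y * y ≤ 0#
    x*x+y*y≤0 = x+y≤0 x*x≤0 y*y≤0

  -- Field inverses only give ¬ ¬ (z ≡ 0), which is not z ≡ 0 constructively; completeness
  -- does the work. The nonnegative z with z * z ≤ 0 form a set closed under addition, so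
  -- s - z bounds it whenever s does; for the supremum s this gives s ≤ s - z.
  0≤x∧x*x≤0⇒x≤0 : ∀ {z} → 0# ≤ z → z * z ≤ 0# → z ≤ 0#
  0≤x∧x*x≤0⇒x≤0 {z} 0≤z z*z≤0 = below-supremum (complete P (0# , P0) (1# , P-bounded))
    where
    P : Carrier → Set
    P x = 0# ≤ x × x * x ≤ 0#

    P0 : P 0#
    P0 = ≤-refl , subst₂ _≤_ (sym (zeroʳ 0#)) refl ≤-refl

    P-bounded : ∀ x → P x → x ≤ 1#
    P-bounded x (0≤x , x*x≤0) with ≤-total x 1#
    ... | inj₁ x≤1 = x≤1
    ... | inj₂ 1≤x = ⊥-elim (1≰0 (begin
      1#      ≡⟨ *-identityˡ 1# ⟨
      1# * 1# ≤⟨ *-monoˡ-≤-nonneg 0≤1 1≤x ⟩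
      1# * x  ≡⟨ *-comm 1# x ⟩
      x * 1#  ≤⟨ *-monoˡ-≤-nonneg 0≤x 1≤x ⟩
      x * x   ≤⟨ x*x≤0 ⟩
      0#      ∎))

    below-supremum : (∃ λ s → (∀ x → P x → x ≤ s) × (∀ b → (∀ x → P x → x ≤ b) → s ≤ b)) →
                     z ≤ 0#
    below-supremum (s , upper , least) = x≤x-y⇒y≤0 (least (s - z) λ y (0≤y , y*y≤0) →
      x+y≤z⇒y≤z-x (upper (z + y) (0≤x+y 0≤z 0≤y , [x+y]*[x+y]≤0 z*z≤0 y*y≤0)))

  x*x≤0⇒x≡0 : ∀ {x} → x * x ≤ 0# → x ≡ 0#
  x*x≤0⇒x≡0 {x} x*x≤0 with ≤-total 0# x
  ... | inj₁ 0≤x = ≤-antisym (0≤x∧x*x≤0⇒x≤0 0≤x x*x≤0) 0≤x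
  ... | inj₂ x≤0 = begin-equality
    x       ≡⟨ -‿involutive x ⟨
    - - x   ≡⟨ cong -_ -x≡0 ⟩
    - 0#    ≡⟨ -0#≈0# ⟩
    0#      ∎
    where
    0≤-x : 0# ≤ - x
    0≤-x = x≤0⇒0≤-x x≤0
    -x≡0 : - x ≡ 0#
    -x≡0 = ≤-antisym (0≤x∧x*x≤0⇒x≤0 0≤-x (subst₂ _≤_ (sym (-x*-x≡x*x x)) refl x*x≤0))
                     0≤-x

module GeometryProperties (R : RealField) where
  open RealField R
  open Geometry R
  open RealFieldProperties R
  open ≤-Reasoning poset

  ∑-cong : ∀ {n} {f g : Fin n → Carrier} → f ≗ g → ∑ f ≡ ∑ g
  ∑-cong {ℕ.zero} f≗g = refl
  ∑-cong {ℕ.suc n} f≗g = cong₂ _+_ (f≗g zero) (∑-cong (λ i → f≗g (suc i)))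

  ∑-zero : ∀ {n} {f : Fin n → Carrier} → (∀ i → f i ≡ 0#) → ∑ f ≡ 0#
  ∑-zero {ℕ.zero} f≡0 = refl
  ∑-zero {ℕ.suc n} f≡0 =
    trans (cong₂ _+_ (f≡0 zero) (∑-zero (λ i → f≡0 (suc i)))) (+-identityˡ 0#)

  ∑-mono-≤ : ∀ {n} {f g : Fin n → Carrier} → (∀ i → f i ≤ g i) → ∑ f ≤ ∑ g
  ∑-mono-≤ {ℕ.zero} f≤g = ≤-refl
  ∑-mono-≤ {ℕ.suc n} f≤g = +-mono-≤ (f≤g zero) (∑-mono-≤ (λ i → f≤g (suc i)))

  ∑-nonneg : ∀ {n} {f : Fin n → Carrier} → (∀ i → 0# ≤ f i) → 0# ≤ ∑ f
  ∑-nonneg {ℕ.zero} 0≤f = ≤-refl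
  ∑-nonneg {ℕ.suc n} 0≤f = 0≤x+y (0≤f zero) (∑-nonneg (λ i → 0≤f (suc i)))

  ∑-nonneg-≤0⇒≤0 : ∀ {n} {f : Fin n → Carrier} →
                   (∀ i → 0# ≤ f i) → ∑ f ≤ 0# → ∀ i → f i ≤ 0#
  ∑-nonneg-≤0⇒≤0 {ℕ.suc n} {f} 0≤f ∑f≤0 zero = begin
    f zero                            ≡⟨ +-identityʳ (f zero) ⟨
    f zero + 0#                       ≤⟨ +-monoʳ-≤ (f zero) (∑-nonneg (λ i → 0≤f (suc i))) ⟩
    f zero + ∑ (λ i → f (suc i))      ≤⟨ ∑f≤0 ⟩
    0#                                ∎
  ∑-nonneg-≤0⇒≤0 {ℕ.suc n} {f} 0≤f ∑f≤0 (suc i) =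
    ∑-nonneg-≤0⇒≤0 (λ i → 0≤f (suc i)) ∑tail≤0 i
    where
    ∑tail≤0 : ∑ (λ i → f (suc i)) ≤ 0#
    ∑tail≤0 = begin
      ∑ (λ i → f (suc i))             ≡⟨ +-identityˡ _ ⟨
      0# + ∑ (λ i → f (suc i))        ≤⟨ +-monoˡ-≤ _ (0≤f zero) ⟩
      f zero + ∑ (λ i → f (suc i))    ≤⟨ ∑f≤0 ⟩
      0#                              ∎

  ∑-+ : ∀ {n} (f g : Fin n → Carrier) → ∑ (λ i → f i + g i) ≡ ∑ f + ∑ g
  ∑-+ {ℕ.zero} f g = sym (+-identityˡ 0#)
  ∑-+ {ℕ.suc n} f g = trans (cong (f zero + g zero +_) (∑-+ (λ i → f (suc i)) (λ i → g (suc i))))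
    (solve 4 (λ a b c d → (a :+ b) :+ (c :+ d) := (a :+ c) :+ (b :+ d)) refl _ _ _ _)

  ∑-*ˡ : ∀ {n} c (f : Fin n → Carrier) → ∑ (λ i → c * f i) ≡ c * ∑ f
  ∑-*ˡ {ℕ.zero} c f = sym (zeroʳ c)
  ∑-*ˡ {ℕ.suc n} c f =
    trans (cong (c * f zero +_) (∑-*ˡ c (λ i → f (suc i)))) (sym (distribˡ c _ _))

  0≤dist : ∀ {d} (a b : Point d) → 0# ≤ dist a b
  0≤dist a b = ∑-nonneg (λ i → 0≤x*x (a i - b i))

  dist-self : ∀ {d} (a : Point d) → dist a a ≡ 0#
  dist-self a = ∑-zero (λ i → trans (cong (λ t → t * t) (-‿inverseʳ (a i))) (zeroʳ 0#))

  dist-cong : ∀ {d} {a a′ b b′ : Point d} → a ≗ a′ → b ≗ b′ → dist a b ≡ dist a′ b′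
  dist-cong a≗a′ b≗b′ = ∑-cong (λ i → cong₂ (λ s t → (s - t) * (s - t)) (a≗a′ i) (b≗b′ i))

  dist≤0⇒≗ : ∀ {d} {a b : Point d} → dist a b ≤ 0# → a ≗ b
  dist≤0⇒≗ {a = a} {b} dist≤0 i =
    x∙y⁻¹≈ε⇒x≈y (a i) (b i) (x*x≤0⇒x≡0 (∑-nonneg-≤0⇒≤0 (λ j → 0≤x*x (a j - b j)) dist≤0 i))

  [x+y+z]²≤three*[x²+y²+z²] : ∀ x y z →
    (x + y + z) * (x + y + z) ≤ three * (x * x + y * y + z * z)
  [x+y+z]²≤three*[x²+y²+z²] x y z = begin
    (x + y + z) * (x + y + z)
      ≡⟨ solve 3 (λ x y z → (x :+ y :+ z) :* (x :+ y :+ z)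
                  := x :* x :+ y :* y :+ z :* z
                     :+ ((x :* y :+ x :* y) :+ (y :* z :+ y :* z) :+ (x :* z :+ x :* z))) refl x y z ⟩
    x * x + y * y + z * z + ((x * y + x * y) + (y * z + y * z) + (x * z + x * z))
      ≤⟨ +-monoʳ-≤ (x * x + y * y + z * z)
           (+-mono-≤ (+-mono-≤ (x*y+x*y≤x*x+y*y x y) (x*y+x*y≤x*x+y*y y z))
                     (x*y+x*y≤x*x+y*y x z)) ⟩
    x * x + y * y + z * z + ((x * x + y * y) + (y * y + z * z) + (x * x + z * z))
      ≡⟨ solve 3 (λ x y z → x :* x :+ y :* y :+ z :* z
                              :+ ((x :* x :+ y :* y) :+ (y :* y :+ z :* z) :+ (x :* x :+ z :* z))
                  := (con 1 :+ con 1 :+ con 1) :* (x :* x :+ y :* y :+ z :* z)) refl x y z ⟩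
    three * (x * x + y * y + z * z)
      ∎

  dist-triangle₃ : ∀ {d} (a p q b : Point d) →
                   dist a b ≤ three * (dist a p + dist p q + dist q b)
  dist-triangle₃ {d} a p q b = begin
    dist a b
      ≡⟨ ∑-cong (λ i → cong (λ t → t * t) (telescope i)) ⟨
    ∑ (λ i → (A i + B i + C i) * (A i + B i + C i))
      ≤⟨ ∑-mono-≤ (λ i → [x+y+z]²≤three*[x²+y²+z²] (A i) (B i) (C i)) ⟩
    ∑ (λ i → three * (A i * A i + B i * B i + C i * C i))
      ≡⟨ ∑-*ˡ {d} three _ ⟩
    three * ∑ (λ i → A i * A i + B i * B i + C i * C i)
      ≡⟨ cong (three *_) (trans (∑-+ {d} _ _) (cong (_+ dist q b) (∑-+ {d} _ _))) ⟩
    three * (dist a p + dist p q + dist q b)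
      ∎
    where
    A B C : Fin d → Carrier
    A i = a i - p i
    B i = p i - q i
    C i = q i - b i

    telescope : ∀ i → A i + B i + C i ≡ a i - b i
    telescope i = begin-equality
      A i + B i + C i
        ≡⟨ solve 6 (λ a p q -b -p -q → (a :+ -p) :+ (p :+ -q) :+ (q :+ -b)
                                      := (a :+ -b) :+ (p :+ -p) :+ (q :+ -q))
                 refl (a i) (p i) (q i) (- b i) (- p i) (- q i) ⟩
      a i - b i + (p i - p i) + (q i - q i)
        ≡⟨ cong₂ (λ s t → a i - b i + s + t) (-‿inverseʳ (p i)) (-‿inverseʳ (q i)) ⟩
      a i - b i + 0# + 0#
        ≡⟨ trans (+-identityʳ _) (+-identityʳ _) ⟩
      a i - b i
        ∎

  module _ {d m} (S : Fin m → Point d) (vor : Point d → Fin m) where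

    dist≤three*hdist : ∀ x c → dist x c ≤ three * hdist S vor x c
    dist≤three*hdist x c = dist-triangle₃ x (S (vor x)) (S (vor c)) c

    costD≤three*costH : ∀ {n k} (X : Fin n → Point d) (C : Fin k → Point d) (π : Fin n → Fin k) →
                        costD X C π ≤ three * costH S vor X C π
    costD≤three*costH X C π = begin
      costD X C π
        ≤⟨ ∑-mono-≤ (λ j → dist≤three*hdist (X j) (C (π j))) ⟩
      ∑ (λ j → three * hdist S vor (X j) (C (π j)))
        ≡⟨ ∑-*ˡ three (λ j → hdist S vor (X j) (C (π j))) ⟩
      three * costH S vor X C π
        ∎

    module _ (isVoronoi : IsVoronoi S vor) where

      vor-site : ∀ j → S (vor (S j)) ≗ S j
      vor-site j i = sym (dist≤0⇒≗ (subst₂ _≤_ refl (dist-self (S j)) (isVoronoi (S j) j)) i)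

      hdist-vor : ∀ x c → hdist S vor x (S (vor c)) ≤ hdist S vor x c
      hdist-vor x c = begin
        dist x v + dist v (S (vor p)) + dist (S (vor p)) p
          ≡⟨ cong₂ (λ s t → dist x v + s + t)
                   (dist-cong (λ _ → refl) site) (dist-cong site (λ _ → refl)) ⟩
        dist x v + dist v p + dist p p
          ≡⟨ cong (dist x v + dist v p +_) (dist-self p) ⟩
        dist x v + dist v p + 0#
          ≤⟨ +-monoʳ-≤ (dist x v + dist v p) (0≤dist p c) ⟩
        dist x v + dist v p + dist p c
          ∎
        where
        v p : Point d
        v = S (vor x)
        p = S (vor c)
        site : S (vor p) ≗ p
        site = vor-site (vor c)

      costH-vor : ∀ {n k} (X : Fin n → Point d) (C : Fin k → Point d) (π : Fin n → Fin k) →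
                  costH S vor X (λ i → S (vor (C i))) π ≤ costH S vor X C π
      costH-vor X C π = ∑-mono-≤ (λ j → hdist-vor (X j) (C (π j)))

open import Data.Nat using (ℕ; _≤_; _*_)
open import Function.Definitions using (Injective)

lemma5 : (R : RealField) → let open Geometry R in
    (d n k u m : ℕ) →
    (X : Fin n → Point d) → Injective _≡_ _≡_ X →
    1 ≤ k → k ≤ n → 1 ≤ u → n ≤ k * u →
    (S : Fin m → Point d) → 1 ≤ m →
    (vor : Point d → Fin m) → IsVoronoi S vor →
    (C : Fin k → Fin m) → (πH : Fin n → Fin k) → Feasible u πH →
    (∀ (C′ : Fin k → Fin m) (π′ : Fin n → Fin k) → Feasible u π′ →
       costH S vor X (λ i → S (C i)) πH ≤ℝ costH S vor X (λ i → S (C′ i)) π′) →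
    (πC : Fin n → Fin k) → Feasible u πC →
    (∀ (π′ : Fin n → Fin k) → Feasible u π′ →
       costD X (λ i → S (C i)) πC ≤ℝ costD X (λ i → S (C i)) π′) →
    Feasible u πC ×
    (∀ (C′ : Fin k → Point d) (π′ : Fin n → Fin k) → Feasible u π′ →
       costD X (λ i → S (C i)) πC ≤ℝ (three ·ℝ costH S vor X C′ π′))
-- Injectivity of X and the bounds on k, u, m only make the optimisation problems nonempty;
-- the approximation bound holds without them.
lemma5 R d n k u m X _ _ _ _ _ S _ vor isVoronoi C πH πH-feasible πH-optimal
       πC πC-feasible πC-optimal =
  πC-feasible , λ C′ π′ π′-feasible → begin
    costD X c πC                               ≤⟨ πC-optimal πH πH-feasible ⟩
    costD X c πH                               ≤⟨ costD≤three*costH S vor X c πH ⟩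
    three ·ℝ costH S vor X c πH                ≤⟨ *-monoˡ-≤-nonneg 0≤three (begin
      costH S vor X c πH                          ≤⟨ πH-optimal (λ i → vor (C′ i)) π′ π′-feasible ⟩
      costH S vor X (λ i → S (vor (C′ i))) π′     ≤⟨ costH-vor S vor isVoronoi X C′ π′ ⟩
      costH S vor X C′ π′                         ∎) ⟩
    three ·ℝ costH S vor X C′ π′               ∎
  where
  open Geometry R
  open RealFieldProperties R using (*-monoˡ-≤-nonneg; 0≤three; poset)
  open GeometryProperties R using (costD≤three*costH; costH-vor)
  open ≤-Reasoning poset

  c : Fin k → Point d
  c i = S (C i)
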